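{- For every family $\mathfrak{R}_A=(\mathfrak{R}_a)_{a\in A}$ of $S5$-modal relations and every maximally-consistent base $\mathscr{B}$: (i) $\nVdash_{\mathscr{B},\mathfrak{R}_A}\bot$; and (ii) for all formulae $\phi,\psi$, $\Vdash_{\mathscr{B},\mathfrak{R}_A}\phi\to\psi$ iff ($\nVdash_{\mathscr{B},\mathfrak{R}_A}\phi$ or $\Vdash_{\mathscr{B},\mathfrak{R}_A}\psi$).
   Context: Fix a countably infinite set of atomic formulae and a nonempty set $A$ of agents. Formulae: $\phi ::= p \mid \bot \mid \phi\to\phi \mid K_a\phi$ with $p$ atomic and $a\in A$. A base rule is written $p_1,\dots,p_n\Rightarrow p$, where $\{p_1,\dots,p_n\}$ is a finite (possibly empty) set of atoms and $p$ is an atom. A base is a countable set of base rules; $\Omega$ is the set of all bases. $\overline{\mathscr{B}}$ is the smallest set of atoms closed under the rules of $\mathscr{B}$. A base $\mathscr{B}$ is inconsistent iff every atom lies in $\overline{\mathscr{B}}$, and consistent otherwise. A base $\mathscr{B}$ is maximally-consistent iff it is consistent and for every base rule $\delta$, either $\delta\in\mathscr{B}$ or $\mathscr{B}\cup\{\delta\}$ is inconsistent. An $S5$-modal relation is a binary relation $\mathfrak{R}$ on $\Omega$ that is reflexive, transitive and Euclidean (if $\mathfrak{R}\mathscr{B}\mathscr{C}$ and $\mathfrak{R}\mathscr{B}\mathscr{D}$ then $\mathfrak{R}\mathscr{C}\mathscr{D}$) and satisfies, for all bases $\mathscr{B}$: (a) if $\mathscr{B}$ is inconsistent, there is an inconsistent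 $\mathscr{C}$ with $\mathfrak{R}\mathscr{B}\mathscr{C}$, and every $\mathscr{D}$ with $\mathfrak{R}\mathscr{B}\mathscr{D}$ is inconsistent; (b) if $\mathscr{B}$ is consistent, every $\mathscr{C}$ with $\mathfrak{R}\mathscr{B}\mathscr{C}$ is consistent; (c) for all $\mathscr{C}$, if $\mathfrak{R}\mathscr{B}\mathscr{C}$ then for every consistent $\mathscr{D}\supseteq\mathscr{B}$ there is $\mathscr{E}\supseteq\mathscr{C}$ with $\mathfrak{R}\mathscr{D}\mathscr{E}$; (d) for all consistent $\mathscr{C}$, if $\mathfrak{R}\mathscr{B}\mathscr{C}$ then for every $\mathscr{D}\subseteq\mathscr{B}$ there is $\mathscr{E}\subseteq\mathscr{C}$ with $\mathfrak{R}\mathscr{D}\mathscr{E}$. For a family $\mathfrak{R}_A=(\mathfrak{R}_a)_{a\in A}$ of $S5$-modal relations, validity at a base is defined inductively: $\Vdash_{\mathscr{B},\mathfrak{R}_A}p$ iff $p\in\overline{\mathscr{B}}$; $\Vdash_{\mathscr{B},\mathfrak{R}_A}\phi\to\psi$ iff $\phi\Vdash_{\mathscr{B},\mathfrak{R}_A}\psi$; $\Vdash_{\mathscr{B},\mathfrak{R}_A}\bot$ iff $\Vdash_{\mathscr{B},\mathfrak{R}_A}p$ for every atom $p$; $\Vdash_{\mathscr{B},\mathfrak{R}_A}K_a\phi$ iff $\Vdash_{\mathscr{C},\mathfrak{R}_A}\phi$ for all $\mathscr{C}$ with $\mathfrak{R}_a\mathscr{B}\mathscr{C}$; and for a nonempty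 set $\Gamma$ of formulae, $\Gamma\Vdash_{\mathscr{B},\mathfrak{R}_A}\phi$ iff for every $\mathscr{C}\supseteq\mathscr{B}$, if $\Vdash_{\mathscr{C},\mathfrak{R}_A}\psi$ for all $\psi\in\Gamma$ then $\Vdash_{\mathscr{C},\mathfrak{R}_A}\phi$. -}

module Defs where

open import Level using (Level; Lift; lift) renaming (suc to lsuc; zero to lzero)
open import Data.Nat using (ℕ)
open import Data.List using (List)
open import Data.List.Membership.Propositional using (_∈_)
open import Data.Product using (Σ; _×_; _,_; proj₁; proj₂)
open import Data.Sum using (_⊎_)
open import Relation.Nullary using (¬_)
open import Relation.Binary.PropositionalEquality using (_≡_)
open import Function.Bundles using (_⇔_)

Atom : Set
Atom = ℕ

data Formula (A : Set) : Set where
  atom : Atom → Formula A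
  ⊥'   : Formula A
  _⇒_  : Formula A → Formula A → Formula A
  K    : A → Formula A → Formula A

record Rule : Set where
  constructor _⟹_
  field
    premises   : List Atom
    conclusion : Atom
open Rule public

-- Two rules are the same base rule iff they have the same premise SET and conclusion.
SameRule : Rule → Rule → Set
SameRule r s = ((x : Atom) → (x ∈ premises r) ⇔ (x ∈ premises s)) × (conclusion r ≡ conclusion s)

-- A base: a set of base rules (a predicate on rules, invariant under the
-- representation of the premise set). Every such set is countable since
-- the set of rules is countable.
record Base : Set₁ where
  field
    _∋_     : Rule → Set
    respect : ∀ {r s} → SameRule r s → _∋_ r → _∋_ s
open Base public

_⊆_ : Base → Base → Set
B ⊆ C = ∀ r → B ∋ r → C ∋ r

_∪⟨_⟩ : Base → Rule → Base
(B ∪⟨ δ ⟩) ._∋_ r = (B ∋ r) ⊎ SameRule δ r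
(B ∪⟨ δ ⟩) .respect {r} {s} e (Data.Sum.inj₁ x) = Data.Sum.inj₁ (respect B e x)
(B ∪⟨ δ ⟩) .respect {r} {s} (e₁ , e₂) (Data.Sum.inj₂ (f₁ , f₂)) =
  Data.Sum.inj₂ ((λ x → Function.Bundles.mk⇔
                     (λ y → Function.Bundles.Equivalence.to (e₁ x) (Function.Bundles.Equivalence.to (f₁ x) y))
                     (λ y → Function.Bundles.Equivalence.from (f₁ x) (Function.Bundles.Equivalence.from (e₁ x) y)))
                , Relation.Binary.PropositionalEquality.trans f₂ e₂)

data Derivable (B : Base) : Atom → Set where
  use : (r : Rule) → B ∋ r → ((x : Atom) → x ∈ premises r → Derivable B x) →
        Derivable B (conclusion r)

Inconsistent : Base → Set
Inconsistent B = (p : Atom) → Derivable B p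

Consistent : Base → Set
Consistent B = ¬ Inconsistent B

MaximallyConsistent : Base → Set
MaximallyConsistent B =
  Consistent B × ((δ : Rule) → (B ∋ δ) ⊎ Inconsistent (B ∪⟨ δ ⟩))

Rel : Set₂
Rel = Base → Base → Set₁

record IsS5 (R : Rel) : Set₁ where
  field
    reflexive  : ∀ B → R B B
    transitive : ∀ B C D → R B C → R C D → R B D
    euclidean  : ∀ B C D → R B C → R B D → R C D
    condA      : ∀ B → Inconsistent B →
                   (Σ Base λ C → R B C × Inconsistent C) × (∀ D → R B D → Inconsistent D)
    condB      : ∀ B → Consistent B → ∀ C → R B C → Consistent C
    condC      : ∀ B C → R B C → ∀ D → Consistent D → B ⊆ D →
                   Σ Base λ E → C ⊆ E × R D E
    condD      : ∀ B C → Consistent C → R B C → ∀ D → D ⊆ B →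
                   Σ Base λ E → E ⊆ C × R D E

module _ {A : Set} (R : A → Rel) where
  Valid : Formula A → Base → Set₁
  Valid (atom p) B = Lift (lsuc lzero) (Derivable B p)
  Valid ⊥' B       = (p : Atom) → Valid (atom p) B
  Valid (φ ⇒ ψ) B  = (C : Base) → B ⊆ C → Valid φ C → Valid ψ C
  Valid (K a φ) B  = (C : Base) → R a B C → Valid φ C

-- A maximally consistent base B has no consistent proper extension, so the
-- bases C ⊇ B quantified over in ⊩_B φ → ψ are B itself and inconsistent
-- bases, at which every formula is valid. Together with monotonicity of
-- validity along ⊆ (for K_a this is condition (d)), the implication at B
-- reduces to its classical truth table.
module Submission where

open import Defs
open import Data.Product using (_×_; _,_; proj₂)
open import Data.Sum using (_⊎_; inj₁; inj₂)
open import Data.Empty using (⊥-elim)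
open import Relation.Nullary using (¬_; Dec; yes; no)
open import Relation.Nullary.Decidable using (map′)
open import Function.Bundles using (_⇔_; mk⇔)
open import Axiom.ExcludedMiddle using (ExcludedMiddle)
open import Level using (suc; zero; lift; lower)

⊆-refl : ∀ {B} → B ⊆ B
⊆-refl _ r∈B = r∈B

∪⟨⟩-⊆ : ∀ {B C δ} → B ⊆ C → C ∋ δ → (B ∪⟨ δ ⟩) ⊆ C
∪⟨⟩-⊆         B⊆C δ∈C r (inj₁ r∈B) = B⊆C r r∈B
∪⟨⟩-⊆ {C = C} B⊆C δ∈C r (inj₂ δ≈r) = respect C δ≈r δ∈C

Derivable-mono : ∀ {B C p} → B ⊆ C → Derivable B p → Derivable C p
Derivable-mono B⊆C (use r r∈B premises⊢) =
  use r (B⊆C r r∈B) (λ x x∈ → Derivable-mono B⊆C (premises⊢ x x∈))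

Inconsistent-mono : ∀ {B C} → B ⊆ C → Inconsistent B → Inconsistent C
Inconsistent-mono B⊆C B-inc p = Derivable-mono B⊆C (B-inc p)

inconsistent? : ExcludedMiddle (suc zero) → ∀ B → Dec (Inconsistent B)
inconsistent? lem B = map′ lower lift lem

maximallyConsistent-⊇⇒⊆ : ∀ {B C} → MaximallyConsistent B →
                          B ⊆ C → Consistent C → C ⊆ B
maximallyConsistent-⊇⇒⊆ {B} {C} (_ , maximal) B⊆C C-con δ δ∈C with maximal δ
... | inj₁ δ∈B     = δ∈B
... | inj₂ B∪δ-inc = ⊥-elim (C-con (Inconsistent-mono (∪⟨⟩-⊆ {B} {C} {δ} B⊆C δ∈C) B∪δ-inc))

module _ {A : Set} (R : A → Rel) where

  consistent⇒¬valid-⊥ : ∀ {B} → Consistent B → ¬ Valid R ⊥' B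
  consistent⇒¬valid-⊥ B-con B⊩⊥ = B-con (λ p → lower (B⊩⊥ p))

  valid-⇒⇒¬valid⊎valid : ExcludedMiddle (suc zero) → ∀ φ ψ {B} →
                         Valid R (φ ⇒ ψ) B → (¬ Valid R φ B) ⊎ Valid R ψ B
  valid-⇒⇒¬valid⊎valid lem φ ψ {B} B⊩φ⇒ψ with lem {Valid R φ B}
  ... | yes B⊩φ  = inj₂ (B⊩φ⇒ψ B (⊆-refl {B}) B⊩φ)
  ... | no  ¬B⊩φ = inj₁ ¬B⊩φ

module _ {A : Set} (R : A → Rel) (S5 : (a : A) → IsS5 (R a)) where

  inconsistent⇒valid : ∀ φ {B} → Inconsistent B → Valid R φ B
  inconsistent⇒valid (atom p) B-inc       = lift (B-inc p)
  inconsistent⇒valid ⊥'       B-inc p     = lift (B-inc p)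
  inconsistent⇒valid (φ ⇒ ψ)  B-inc C B⊆C _ =
    inconsistent⇒valid ψ (Inconsistent-mono B⊆C B-inc)
  inconsistent⇒valid (K a φ)  {B} B-inc C RBC =
    inconsistent⇒valid φ (proj₂ (IsS5.condA (S5 a) B B-inc) C RBC)

  valid-mono : ExcludedMiddle (suc zero) →
               ∀ φ {B C} → B ⊆ C → Valid R φ B → Valid R φ C
  valid-mono lem (atom p) B⊆C (lift B⊢p) = lift (Derivable-mono B⊆C B⊢p)
  valid-mono lem ⊥'       B⊆C B⊩⊥ p      = valid-mono lem (atom p) B⊆C (B⊩⊥ p)
  valid-mono lem (φ ⇒ ψ)  B⊆C B⊩φ⇒ψ D C⊆D =
    B⊩φ⇒ψ D (λ r r∈B → C⊆D r (B⊆C r r∈B))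
  valid-mono lem (K a φ) {B} {C} B⊆C B⊩Kφ E RCE with inconsistent? lem C
  ... | yes C-inc = inconsistent⇒valid φ (proj₂ (IsS5.condA (S5 a) C C-inc) E RCE)
  ... | no  C-con with IsS5.condD (S5 a) C E (IsS5.condB (S5 a) C C-con E RCE) RCE B B⊆C
  ...   | E′ , E′⊆E , RBE′ = valid-mono lem φ E′⊆E (B⊩Kφ E′ RBE′)

  ¬valid⊎valid⇒valid-⇒ : ExcludedMiddle (suc zero) → ∀ {B} → MaximallyConsistent B →
                         ∀ φ ψ → (¬ Valid R φ B) ⊎ Valid R ψ B → Valid R (φ ⇒ ψ) B
  ¬valid⊎valid⇒valid-⇒ lem B-mc φ ψ (inj₂ B⊩ψ) C B⊆C _ = valid-mono lem ψ B⊆C B⊩ψ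
  ¬valid⊎valid⇒valid-⇒ lem B-mc φ ψ (inj₁ ¬B⊩φ) C B⊆C C⊩φ with inconsistent? lem C
  ... | yes C-inc = inconsistent⇒valid ψ C-inc
  ... | no  C-con =
    ⊥-elim (¬B⊩φ (valid-mono lem φ (maximallyConsistent-⊇⇒⊆ B-mc B⊆C C-con) C⊩φ))

lemma4p6 : ExcludedMiddle (suc zero) →
           (A : Set) → A →
           (R : A → Rel) → ((a : A) → IsS5 (R a)) →
           (B : Base) → MaximallyConsistent B →
           (¬ Valid R ⊥' B) ×
           ((φ ψ : Formula A) → Valid R (φ ⇒ ψ) B ⇔ ((¬ Valid R φ B) ⊎ Valid R ψ B))
lemma4p6 lem _ _ R S5 B B-mc@(B-con , _) =
  consistent⇒¬valid-⊥ R B-con ,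
  λ φ ψ → mk⇔ (valid-⇒⇒¬valid⊎valid R lem φ ψ) (¬valid⊎valid⇒valid-⇒ R S5 lem B-mc φ ψ)
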